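{- Let $m \geq 2$ and $n \geq 1$ be integers, and let $R \subseteq \{1, 2, \dots, m-1\}$ be non-empty. The number of compositions of $n$ all of whose parts are congruent modulo $m$ to some element of $R$ equals the number of compositions of $n$ all of whose parts lie in $R \cup \{m\}$ and whose last part lies in $R$.
   Context: A composition of $n$ is a finite sequence of positive integers (its parts) summing to $n$, with order mattering. -}

module Defs where

open import Data.Nat using (ℕ; zero; suc; _+_; _∸_; _≤_; _<_; _≟_; _≤?_; _%_; NonZero)
open import Data.List using (List; []; _∷_; length; filter; map; concatMap; upTo; last)
open import Data.Nat.ListAction using (sum)
open import Data.List.Relation.Unary.All using (All; all?)
open import Data.List.Relation.Unary.Any using (Any; any?)
open import Data.Maybe using (Maybe; just; nothing)
open import Data.Product using (_×_; Σ)
open import Relation.Binary.PropositionalEquality using (_≡_)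
open import Relation.Nullary using (Dec; yes; no; ¬_)
open import Data.Empty using (⊥)
open import Data.Unit using (⊤)

-- compsAux fuel n : all compositions of n (lists of positive integers
-- summing to n), provided fuel ≥ n.  The first part k ranges over 1..n.
compsAux : ℕ → ℕ → List (List ℕ)
compsAux _ zero = [] ∷ []
compsAux zero (suc n) = []
compsAux (suc fuel) (suc n) =
  concatMap (λ i → map (suc i ∷_) (compsAux fuel (n ∸ i))) (upTo (suc n))

Compositions : ℕ → List (List ℕ)
Compositions n = compsAux n n

IsComposition : ℕ → List ℕ → Set
IsComposition n c = All (λ p → 1 ≤ p) c × sum c ≡ n

countComps : (n : ℕ) → (P : List ℕ → Set) → ((c : List ℕ) → Dec (P c)) → ℕ
countComps n P P? = length (filter P? (Compositions n))

CongIn : (m : ℕ) .{{_ : NonZero m}} → List ℕ → ℕ → Set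
CongIn m R x = Any (λ r → x % m ≡ r % m) R

congIn? : (m : ℕ) .{{_ : NonZero m}} (R : List ℕ) (x : ℕ) → Dec (CongIn m R x)
congIn? m R x = any? (λ r → x % m ≟ r % m) R

AllCong : (m : ℕ) .{{_ : NonZero m}} → List ℕ → List ℕ → Set
AllCong m R c = All (CongIn m R) c

allCong? : (m : ℕ) .{{_ : NonZero m}} (R : List ℕ) (c : List ℕ) → Dec (AllCong m R c)
allCong? m R c = all? (congIn? m R) c

InR : List ℕ → ℕ → Set
InR R x = Any (x ≡_) R

inR? : (R : List ℕ) (x : ℕ) → Dec (InR R x)
inR? R x = any? (x ≟_) R

LastIn : List ℕ → List ℕ → Set
LastIn R c with last c
... | just x = InR R x
... | nothing = ⊥

lastIn? : (R : List ℕ) (c : List ℕ) → Dec (LastIn R c)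
lastIn? R c with last c
... | just x = inR? R x
... | nothing = no (λ ())

InRm : (m : ℕ) → List ℕ → List ℕ → Set
InRm m R c = All (λ p → InR R p ⊎' (p ≡ m)) c × LastIn R c
  where
  open import Data.Sum renaming (_⊎_ to _⊎'_)

inRm? : (m : ℕ) (R : List ℕ) (c : List ℕ) → Dec (InRm m R c)
inRm? m R c = all? (λ p → inR? R p ⊎-dec (p ≟ m)) c ×-dec lastIn? R c
  where
  open import Relation.Nullary.Decidable using (_⊎-dec_; _×-dec_)

-- Sort compositions by their first part j.  The congruent compositions then satisfy
-- A(n) = Σ_j χ(j) A(n − j), where χ(j) = [j ≡ r (mod m) for some r ∈ R].  As
-- χ(j) = [j ∈ R] for j ≤ m and χ(j) = χ(j − m) for j > m, the terms with j > m add up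
-- to the same sum for n − m, so A(n) = Σ_{r ∈ R} A(n − r) + A(n − m).  A composition
-- counted by B starts with a part in R or with m, which gives B the same recurrence
-- with the same initial values; strong induction on n finishes the proof.
module Submission where

open import Defs
open import Data.Bool using (true; false)
open import Data.List using (List; []; _∷_; _++_; length; filter; map; concatMap; upTo; applyUpTo)
open import Data.List.Membership.Propositional using (_∈_; find; lose)
open import Data.List.Properties
  using (length-++; filter-++; filter-none; filter-accept; map-cong; map-upTo; concatMap-cong)
open import Data.List.Relation.Unary.All as All using (All; []; _∷_; all?; universal)
open import Data.List.Relation.Unary.All.Properties using (concat⁺; map⁺)
import Data.List.Relation.Unary.Any as Any
open import Data.Nat using (ℕ; zero; suc; _+_; _*_; _∸_; _≤_; _<_; s≤s; _≟_; _%_; NonZero)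
open import Data.Nat.Properties
open import Data.Nat.DivMod using (m<n⇒m%n≡m; n%n≡0; [m+n]%n≡m%n)
open import Data.Nat.Induction using (<-rec)
open import Data.Nat.ListAction using (sum)
open import Data.Product using (_×_; _,_; proj₁; proj₂)
open import Data.Sum using (_⊎_; inj₁; inj₂)
open import Function using (_∘_; _⇔_; mk⇔; Equivalence)
open import Level using (Level)
open import Relation.Binary using (tri<; tri≈; tri>)
open import Relation.Binary.PropositionalEquality
  using (_≡_; _≢_; refl; sym; trans; cong; cong₂; subst; module ≡-Reasoning)
open import Relation.Nullary using (¬_; Dec; yes; no; does; contradiction)
open import Relation.Unary using (Pred; Decidable)
open import Algebra.Properties.CommutativeSemigroup +-commutativeSemigroup using (interchange)

open Equivalence using (to; from)
open ≡-Reasoning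

private
  variable
    a b ℓ ℓ′ : Level
    X : Set a
    Y : Set b

count : {P : Pred X ℓ} → Decidable P → List X → ℕ
count P? xs = length (filter P? xs)

module _ {P : Pred X ℓ} (P? : Decidable P) where

  count-++ : ∀ xs ys → count P? (xs ++ ys) ≡ count P? xs + count P? ys
  count-++ xs ys = trans (cong length (filter-++ P? xs ys)) (length-++ (filter P? xs))

  count-concatMap : (f : Y → List X) (xs : List Y) →
                    count P? (concatMap f xs) ≡ sum (map (count P? ∘ f) xs)
  count-concatMap f []       = refl
  count-concatMap f (x ∷ xs) =
    trans (count-++ (f x) (concatMap f xs)) (cong (count P? (f x) +_) (count-concatMap f xs))

  count-map : (f : Y → X) (xs : List Y) → count P? (map f xs) ≡ count (P? ∘ f) xs
  count-map f []       = refl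
  count-map f (x ∷ xs) with does (P? (f x))
  ... | true  = cong suc (count-map f xs)
  ... | false = count-map f xs

count-cong : {P : Pred X ℓ} {Q : Pred X ℓ′} (P? : Decidable P) (Q? : Decidable Q) {xs : List X} →
             All (λ x → P x ⇔ Q x) xs → count P? xs ≡ count Q? xs
count-cong P? Q? []                  = refl
count-cong P? Q? {x ∷ _} (P⇔Q ∷ eqs) with P? x | Q? x
... | yes _  | yes _  = cong suc (count-cong P? Q? eqs)
... | yes px | no ¬qx = contradiction (to P⇔Q px) ¬qx
... | no ¬px | yes qx = contradiction (from P⇔Q qx) ¬px
... | no _   | no _   = count-cong P? Q? eqs

𝟙 : {P : Set ℓ} → Dec P → ℕ
𝟙 (yes _) = 1
𝟙 (no _)  = 0

𝟙-cong : {P : Set ℓ} {Q : Set ℓ′} → P ⇔ Q → (P? : Dec P) (Q? : Dec Q) → 𝟙 P? ≡ 𝟙 Q?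
𝟙-cong P⇔Q (yes _) (yes _) = refl
𝟙-cong P⇔Q (yes p) (no ¬q) = contradiction (to P⇔Q p) ¬q
𝟙-cong P⇔Q (no ¬p) (yes q) = contradiction (from P⇔Q q) ¬p
𝟙-cong P⇔Q (no _)  (no _)  = refl

𝟙-reject : {P : Set ℓ} → ¬ P → (P? : Dec P) → 𝟙 P? ≡ 0
𝟙-reject ¬p (yes p) = contradiction p ¬p
𝟙-reject ¬p (no _)  = refl

count-all?-∷ : {P : Pred X ℓ} (P? : Decidable P) (x : X) (xs : List (List X)) →
               count (all? P? ∘ (x ∷_)) xs ≡ 𝟙 (P? x) * count (all? P?) xs
count-all?-∷ P? x xs with P? x
... | yes px = trans (count-cong _ _ (universal (λ _ → mk⇔ (λ { (_ ∷ pc) → pc }) (px ∷_)) xs))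
                     (sym (+-identityʳ _))
... | no ¬px = cong length (filter-none _ (universal (λ { _ (px ∷ _) → ¬px px }) xs))

sumSplits : (ℕ → ℕ → ℕ) → ℕ → ℕ
sumSplits f n = sum (applyUpTo (λ i → f (suc i) (n ∸ suc i)) n)

sumSplits-cong : ∀ f g n → (∀ j x → x < n → f (suc j) x ≡ g (suc j) x) →
                 sumSplits f n ≡ sumSplits g n
sumSplits-cong f g zero    _   = refl
sumSplits-cong f g (suc n) f≗g = cong₂ _+_ (f≗g 0 n ≤-refl)
  (sumSplits-cong (f ∘ suc) (g ∘ suc) n (λ j x x<n → f≗g (suc j) x (m<n⇒m<1+n x<n)))

sumSplits-+ : ∀ f g n → sumSplits (λ j x → f j x + g j x) n ≡ sumSplits f n + sumSplits g n
sumSplits-+ f g zero    = refl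
sumSplits-+ f g (suc n) = trans (cong (f 1 n + g 1 n +_) (sumSplits-+ (f ∘ suc) (g ∘ suc) n))
  (interchange (f 1 n) (g 1 n) (sumSplits (f ∘ suc) n) (sumSplits (g ∘ suc) n))

conv : (ℕ → ℕ) → (ℕ → ℕ) → ℕ → ℕ
conv w a = sumSplits (λ j x → w j * a x)

conv-cong : ∀ v w a b n → (∀ j → v (suc j) ≡ w (suc j)) → (∀ x → x < n → a x ≡ b x) →
            conv v a n ≡ conv w b n
conv-cong v w a b n v≗w a≗b = sumSplits-cong (λ j x → v j * a x) (λ j x → w j * b x) n
  (λ j x x<n → cong₂ _*_ (v≗w j) (a≗b x x<n))

conv-distribʳ-+ : ∀ v w a n → conv (λ j → v j + w j) a n ≡ conv v a n + conv w a n
conv-distribʳ-+ v w a n = begin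
  conv (λ j → v j + w j) a n
    ≡⟨ sumSplits-cong (λ j x → (v j + w j) * a x) (λ j x → v j * a x + w j * a x) n
                      (λ j x _ → *-distribʳ-+ (a x) (v (suc j)) (w (suc j))) ⟩
  sumSplits (λ j x → v j * a x + w j * a x) n
    ≡⟨ sumSplits-+ (λ j x → v j * a x) (λ j x → w j * a x) n ⟩
  conv v a n + conv w a n
    ∎

conv-zero : ∀ w a n → (∀ j → w (suc j) ≡ 0) → conv w a n ≡ 0
conv-zero w a zero    _   = refl
conv-zero w a (suc n) w≡0 = cong₂ _+_ (cong (_* a n) (w≡0 0)) (conv-zero (w ∘ suc) a n (w≡0 ∘ suc))

conv-point : ∀ a k n → a 0 ≡ 0 → conv (λ j → 𝟙 (j ≟ suc k)) a n ≡ a (n ∸ suc k)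
conv-point a k       zero    a0≡0 = sym a0≡0
conv-point a zero    (suc n) _    = begin
  1 * a n + conv (λ j → 𝟙 (suc j ≟ 1)) a n
    ≡⟨ cong (1 * a n +_) (conv-zero (λ j → 𝟙 (suc j ≟ 1)) a n (λ j → 𝟙-reject (λ ()) (suc (suc j) ≟ 1))) ⟩
  1 * a n + 0
    ≡⟨ trans (+-identityʳ _) (*-identityˡ _) ⟩
  a n
    ∎
conv-point a (suc k) (suc n) a0≡0 = begin
  0 * a n + conv (λ j → 𝟙 (suc j ≟ suc (suc k))) a n
    ≡⟨ conv-cong (λ j → 𝟙 (suc j ≟ suc (suc k))) (λ j → 𝟙 (j ≟ suc k)) a a n
                 (λ j → 𝟙-cong (mk⇔ suc-injective (cong suc)) _ _) (λ _ _ → refl) ⟩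
  conv (λ j → 𝟙 (j ≟ suc k)) a n
    ≡⟨ conv-point a k n a0≡0 ⟩
  a (n ∸ suc k)
    ∎

delay : ℕ → (ℕ → ℕ) → ℕ → ℕ
delay _       _ zero    = 0
delay zero    w (suc j) = w (suc j)
delay (suc m) w (suc j) = delay m w j

delay-≤ : ∀ m w j → j ≤ m → delay m w j ≡ 0
delay-≤ _       _ zero    _         = refl
delay-≤ (suc m) w (suc j) (s≤s j≤m) = delay-≤ m w j j≤m

delay-beyond : ∀ m w k → delay m w (suc m + k) ≡ w (suc k)
delay-beyond zero    w k = refl
delay-beyond (suc m) w k = delay-beyond m w k

conv-delay : ∀ m w a n → conv (delay m w) a n ≡ conv w a (n ∸ m)
conv-delay zero    w a n       = refl
conv-delay (suc m) w a zero    = refl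
conv-delay (suc m) w a (suc n) = conv-delay m w a n

compsAux-fuel : ∀ f g k → k ≤ f → k ≤ g → compsAux f k ≡ compsAux g k
compsAux-fuel f       g       zero    _         _         = refl
compsAux-fuel (suc f) (suc g) (suc k) (s≤s k≤f) (s≤s k≤g) = concatMap-cong
  (λ i → cong (map (suc i ∷_))
              (compsAux-fuel f g (k ∸ i) (≤-trans (m∸n≤m k i) k≤f) (≤-trans (m∸n≤m k i) k≤g)))
  (upTo (suc k))

Compositions-suc : ∀ k → Compositions (suc k) ≡
                         concatMap (λ i → map (suc i ∷_) (Compositions (k ∸ i))) (upTo (suc k))
Compositions-suc k = concatMap-cong
  (λ i → cong (map (suc i ∷_)) (compsAux-fuel k (k ∸ i) (k ∸ i) (m∸n≤m k i) ≤-refl))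
  (upTo (suc k))

Compositions-suc-nonempty : ∀ k → All (_≢ []) (Compositions (suc k))
Compositions-suc-nonempty k = subst (All (_≢ [])) (sym (Compositions-suc k))
  (concat⁺ (map⁺ (universal (λ i → map⁺ (universal (λ _ ()) _)) (upTo (suc k)))))

count-Compositions-suc : {P : Pred (List ℕ) ℓ} (P? : Decidable P) (k : ℕ) →
  count P? (Compositions (suc k)) ≡ sumSplits (λ j x → count (P? ∘ (j ∷_)) (Compositions x)) (suc k)
count-Compositions-suc P? k = begin
  count P? (Compositions (suc k))
    ≡⟨ cong (count P?) (Compositions-suc k) ⟩
  count P? (concatMap parts (upTo (suc k)))
    ≡⟨ count-concatMap P? parts (upTo (suc k)) ⟩
  sum (map (count P? ∘ parts) (upTo (suc k)))
    ≡⟨ cong sum (map-cong (λ i → count-map P? (suc i ∷_) (Compositions (k ∸ i))) (upTo (suc k))) ⟩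
  sum (map byFirstPart (upTo (suc k)))
    ≡⟨ cong sum (map-upTo byFirstPart (suc k)) ⟩
  sum (applyUpTo byFirstPart (suc k))
    ∎
  where
  parts : ℕ → List (List ℕ)
  parts i = map (suc i ∷_) (Compositions (k ∸ i))
  byFirstPart : ℕ → ℕ
  byFirstPart i = count (P? ∘ (suc i ∷_)) (Compositions (k ∸ i))

congIn-resp-% : ∀ {m x y} .{{_ : NonZero m}} {R} → x % m ≡ y % m → CongIn m R x → CongIn m R y
congIn-resp-% x≡y = Any.map (trans (sym x≡y))

InRm-∷ : ∀ {m R j y ys} → InR R j ⊎ j ≡ m → InRm m R (j ∷ y ∷ ys) ⇔ InRm m R (y ∷ ys)
InRm-∷ j-ok = mk⇔ (λ { ((_ ∷ ok) , last∈R) → ok , last∈R })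
                  (λ { (ok , last∈R) → (j-ok ∷ ok) , last∈R })

module Counts (m-1 : ℕ) (R : List ℕ) (R-range : All (λ r → 1 ≤ r × r < suc m-1) R) where

  m : ℕ
  m = suc m-1

  A : ℕ → ℕ
  A n = countComps n (AllCong m R) (allCong? m R)

  B : ℕ → ℕ
  B n = countComps n (InRm m R) (inRm? m R)

  -- B′ differs from B only at 0, where it also counts the empty composition.
  B′ : ℕ → ℕ
  B′ zero    = 1
  B′ (suc n) = B (suc n)

  χCong : ℕ → ℕ
  χCong j = 𝟙 (congIn? m R j)

  χR : ℕ → ℕ
  χR j = 𝟙 (inR? R j)

  R-bounds : ∀ {j} → InR R j → 1 ≤ j × j < m
  R-bounds = All.lookup R-range

  ∉R-≥m : ∀ {j} → m ≤ j → ¬ InR R j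
  ∉R-≥m m≤j j∈R = <⇒≱ (proj₂ (R-bounds j∈R)) m≤j

  congIn⇔inR : ∀ {j} → j < m → CongIn m R j ⇔ InR R j
  congIn⇔inR {j} j<m = mk⇔ congIn⇒inR (λ j∈R → lose j∈R refl)
    where
    congIn⇒inR : CongIn m R j → InR R j
    congIn⇒inR j≡R with find j≡R
    ... | r , r∈R , j≡r[m] = subst (_∈ R) r≡j r∈R
      where
      r≡j : r ≡ j
      r≡j = trans (sym (m<n⇒m%n≡m (proj₂ (R-bounds r∈R)))) (trans (sym j≡r[m]) (m<n⇒m%n≡m j<m))

  ¬congIn-m : ¬ CongIn m R m
  ¬congIn-m m≡R with find m≡R
  ... | r , r∈R , m≡r[m] = <⇒≢ (proj₁ (R-bounds r∈R)) (sym r≡0)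
    where
    r≡0 : r ≡ 0
    r≡0 = trans (sym (m<n⇒m%n≡m (proj₂ (R-bounds r∈R)))) (trans (sym m≡r[m]) (n%n≡0 m))

  χCong-periodic : ∀ k → χCong (suc m + k) ≡ χCong (suc k)
  χCong-periodic k = 𝟙-cong
    (mk⇔ (congIn-resp-% {x = suc m + k} {y = suc k} shift) (congIn-resp-% {x = suc k} {y = suc m + k} (sym shift)))
    (congIn? m R (suc m + k)) (congIn? m R (suc k))
    where
    shift : (suc m + k) % m ≡ suc k % m
    shift = trans (cong (λ i → suc i % m) (+-comm m k)) ([m+n]%n≡m%n (suc k) m)

  χCong-split : ∀ j → χCong j ≡ χR j + delay m χCong j
  χCong-split j with <-cmp j m
  ... | tri< j<m _ _ = begin
    χCong j                  ≡⟨ 𝟙-cong (congIn⇔inR j<m) _ _ ⟩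
    χR j                     ≡⟨ +-identityʳ (χR j) ⟨
    χR j + 0                 ≡⟨ cong (χR j +_) (delay-≤ m χCong j (<⇒≤ j<m)) ⟨
    χR j + delay m χCong j   ∎
  ... | tri≈ _ refl _ = trans (𝟙-reject ¬congIn-m _)
                              (sym (cong₂ _+_ (𝟙-reject (∉R-≥m ≤-refl) _) (delay-≤ m χCong m ≤-refl)))
  ... | tri> _ _ m<j with m≤n⇒∃[o]m+o≡n m<j
  ...   | k , refl = begin
    χCong (suc m + k)                             ≡⟨ χCong-periodic k ⟩
    χCong (suc k)                                 ≡⟨ delay-beyond m χCong k ⟨
    delay m χCong (suc m + k)                     ≡⟨ cong (_+ delay m χCong (suc m + k)) χR≡0 ⟨
    χR (suc m + k) + delay m χCong (suc m + k)    ∎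
    where
    χR≡0 : χR (suc m + k) ≡ 0
    χR≡0 = 𝟙-reject (∉R-≥m (m≤n⇒m≤1+n (m≤m+n m k))) _

  A-rec : ∀ k → A (suc k) ≡ conv χCong A (suc k)
  A-rec k = trans (count-Compositions-suc (allCong? m R) k)
    (sumSplits-cong (λ j x → count (all? (congIn? m R) ∘ (j ∷_)) (Compositions x)) (λ j x → χCong j * A x)
                    (suc k) (λ j x _ → count-all?-∷ (congIn? m R) (suc j) (Compositions x)))

  conv-χCong-rec : ∀ n → conv χCong A n ≡ conv χR A n + conv χCong A (n ∸ m)
  conv-χCong-rec n = begin
    conv χCong A n                              ≡⟨ conv-cong χCong (λ j → χR j + delay m χCong j) A A n
                                                               (χCong-split ∘ suc) (λ _ _ → refl) ⟩
    conv (λ j → χR j + delay m χCong j) A n     ≡⟨ conv-distribʳ-+ χR (delay m χCong) A n ⟩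
    conv χR A n + conv (delay m χCong) A n      ≡⟨ cong (conv χR A n +_) (conv-delay m χCong A n) ⟩
    conv χR A n + conv χCong A (n ∸ m)          ∎

  count-InRm-∷ : ∀ j x (j∈R? : Dec (InR R j)) (j≟m : Dec (j ≡ m)) →
                 count (inRm? m R ∘ (j ∷_)) (Compositions x) ≡ 𝟙 j∈R? * B′ x + 𝟙 j≟m * B x
  count-InRm-∷ j x       (yes j∈R) (yes refl) = contradiction j∈R (∉R-≥m ≤-refl)
  count-InRm-∷ j zero    (yes j∈R) (no _)     =
    cong length (filter-accept (inRm? m R ∘ (j ∷_)) ((inj₁ j∈R ∷ []) , j∈R))
  count-InRm-∷ j (suc t) (yes j∈R) (no _)     =
    trans (count-cong (inRm? m R ∘ (j ∷_)) (inRm? m R) (All.map drop-j (Compositions-suc-nonempty t)))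
          (sym (trans (+-identityʳ _) (+-identityʳ _)))
    where
    drop-j : ∀ {c} → c ≢ [] → InRm m R (j ∷ c) ⇔ InRm m R c
    drop-j {[]}    c≢[] = contradiction refl c≢[]
    drop-j {_ ∷ _} _    = InRm-∷ (inj₁ j∈R)
  count-InRm-∷ j x       (no j∉R)  (yes refl) =
    trans (count-cong (inRm? m R ∘ (m ∷_)) (inRm? m R) (universal drop-m (Compositions x)))
          (sym (+-identityʳ (B x)))
    where
    drop-m : ∀ c → InRm m R (m ∷ c) ⇔ InRm m R c
    drop-m []      = mk⇔ (λ (_ , m∈R) → contradiction m∈R j∉R) (λ ())
    drop-m (_ ∷ _) = InRm-∷ (inj₂ refl)
  count-InRm-∷ j x       (no j∉R)  (no j≢m)   =
    cong length (filter-none (inRm? m R ∘ (j ∷_)) (universal j-bad (Compositions x)))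
    where
    j-bad : ∀ c → ¬ InRm m R (j ∷ c)
    j-bad _ ((inj₁ j∈R ∷ _) , _) = j∉R j∈R
    j-bad _ ((inj₂ j≡m ∷ _) , _) = j≢m j≡m

  B-rec : ∀ n → B n ≡ conv χR B′ n + B (n ∸ m)
  B-rec zero    = refl
  B-rec (suc k) = begin
    B (suc k)
      ≡⟨ count-Compositions-suc (inRm? m R) k ⟩
    sumSplits byFirstPart (suc k)
      ≡⟨ sumSplits-cong byFirstPart (λ j x → χR j * B′ x + 𝟙 (j ≟ m) * B x) (suc k)
                        (λ j x _ → count-InRm-∷ (suc j) x (inR? R (suc j)) (suc j ≟ m)) ⟩
    sumSplits (λ j x → χR j * B′ x + 𝟙 (j ≟ m) * B x) (suc k)
      ≡⟨ sumSplits-+ (λ j x → χR j * B′ x) (λ j x → 𝟙 (j ≟ m) * B x) (suc k) ⟩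
    conv χR B′ (suc k) + conv (λ j → 𝟙 (j ≟ m)) B (suc k)
      ≡⟨ cong (conv χR B′ (suc k) +_) (conv-point B m-1 (suc k) refl) ⟩
    conv χR B′ (suc k) + B (suc k ∸ m)
      ∎
    where
    byFirstPart : ℕ → ℕ → ℕ
    byFirstPart j x = count (inRm? m R ∘ (j ∷_)) (Compositions x)

  B≡conv-χCong : ∀ n → B n ≡ conv χCong A n
  B≡conv-χCong = <-rec _ step
    where
    step : ∀ n → (∀ {x} → x < n → B x ≡ conv χCong A x) → B n ≡ conv χCong A n
    step zero    _  = refl
    step (suc n) IH = begin
      B (suc n)
        ≡⟨ B-rec (suc n) ⟩
      conv χR B′ (suc n) + B (n ∸ m-1)
        ≡⟨ cong₂ _+_ (conv-cong χR χR B′ A (suc n) (λ _ → refl) B′≡A) (IH (s≤s (m∸n≤m n m-1))) ⟩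
      conv χR A (suc n) + conv χCong A (suc n ∸ m)
        ≡⟨ conv-χCong-rec (suc n) ⟨
      conv χCong A (suc n)
        ∎
      where
      B′≡A : ∀ x → x < suc n → B′ x ≡ A x
      B′≡A zero    _   = refl
      B′≡A (suc x) x<n = trans (IH x<n) (sym (A-rec x))

lemma3p1 : (m n : ℕ) .{{_ : NonZero m}} → 2 ≤ m → 1 ≤ n → (R : List ℕ) → ¬ (R ≡ []) → All (λ r → 1 ≤ r × r < m) R → countComps n (AllCong m R) (allCong? m R) ≡ countComps n (InRm m R) (inRm? m R)
lemma3p1 (suc m-1) (suc k) _ _ R _ R-range = begin
  A (suc k)              ≡⟨ A-rec k ⟩
  conv χCong A (suc k)   ≡⟨ B≡conv-χCong (suc k) ⟨
  B (suc k)              ∎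
  where open Counts m-1 R R-range
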